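{- Let $M$ be a finite LTS, $B\subseteq\mathit{Act}$, and $\phi_{off}$ a mapping from $\overline{B}$ to closed modal $\mu$-calculus formulae such that $P_S$ is feasible and a state is $B$-locked if, and only if, it satisfies $\phi_{off}(b)$ for all $b\in\overline{B}$. Then every $B$-progressing and finite path satisfies $P_S$.
   Context: LTS $M=(S,s_{init},\mathit{Act},\mathit{Trans})$ with $S,\mathit{Act}$ finite. Paths: alternating sequences $s_0t_1s_1\dots$ starting in a state, infinite or ending in a state (final state), consecutive. An action occurs on a path if a transition on it carries that label. An action is enabled in $s$ if a transition with that label leaves $s$. $\overline{B}=\mathit{Act}\setminus B$. A state is $B$-locked if all actions enabled in it are in $B$; a path is $B$-progressing if infinite or its final state is $B$-locked. A path $\pi$ satisfies $P_S$ iff for every $a\in\overline{B}$, $a$ occurs infinitely often on $\pi$ or $\pi$ has a suffix every state of which satisfies $\phi_{off}(a)$. A path predicate is feasible if for every LTS, every finite path can be extended to a path of that LTS satisfying it. -}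

module Defs where

open import Data.Nat using (ℕ; zero; suc; _≤_)
open import Data.Fin using (Fin; zero; suc)
open import Data.Fin.Subset using (Subset; _∈_; _∉_)
open import Data.Bool using (Bool; true)
open import Data.List using (List; []; _∷_; _++_)
open import Data.List.Relation.Unary.All using (All)
open import Data.Product using (Σ; ∃; _×_; _,_; proj₂)
open import Data.Sum using (_⊎_; inj₁; inj₂)
open import Data.Unit using (⊤)
open import Data.Empty using (⊥)
open import Relation.Binary.PropositionalEquality using (_≡_)

record LTS (k : ℕ) : Set where
  field
    n     : ℕ
    init  : Fin n
    trans : Fin n → Fin k → Fin n → Bool

-- Modal μ-calculus formulae over actions Fin k with m free (de Bruijn) variables,
-- in positive normal form.  Closed formulae: Form k 0.
data Form (k : ℕ) : ℕ → Set where
  tt ff : ∀ {m} → Form k m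
  var   : ∀ {m} → Fin m → Form k m
  _∧_ _∨_ : ∀ {m} → Form k m → Form k m → Form k m
  ⟨_⟩_ [_]_ : ∀ {m} → Fin k → Form k m → Form k m
  μ ν   : ∀ {m} → Form k (suc m) → Form k m

module _ {k : ℕ} (M : LTS k) where
  open LTS M

  Step : Fin n → Fin k → Fin n → Set
  Step s a t = trans s a t ≡ true

  extend : ∀ {m} → Subset n → (Fin m → Subset n) → Fin (suc m) → Subset n
  extend U ρ zero    = U
  extend U ρ (suc i) = ρ i

  Sat : ∀ {m} → Form k m → (Fin m → Subset n) → Fin n → Set
  Sat tt ρ s = ⊤
  Sat ff ρ s = ⊥
  Sat (var i) ρ s = s ∈ ρ i
  Sat (φ ∧ ψ) ρ s = Sat φ ρ s × Sat ψ ρ s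
  Sat (φ ∨ ψ) ρ s = Sat φ ρ s ⊎ Sat ψ ρ s
  Sat (⟨ a ⟩ φ) ρ s = ∃ λ t → Step s a t × Sat φ ρ t
  Sat ([ a ] φ) ρ s = ∀ t → Step s a t → Sat φ ρ t
  -- least fixpoint: intersection of all pre-fixpoints
  Sat (μ φ) ρ s = ∀ (U : Subset n) → (∀ t → Sat φ (extend U ρ) t → t ∈ U) → s ∈ U
  -- greatest fixpoint: union of all post-fixpoints
  Sat (ν φ) ρ s = ∃ λ (U : Subset n) → (∀ t → t ∈ U → Sat φ (extend U ρ) t) × s ∈ U

  _⊨_ : Fin n → Form k 0 → Set
  s ⊨ φ = Sat φ (λ ()) s

  Valid : Fin n → List (Fin k × Fin n) → Set
  Valid s [] = ⊤
  Valid s ((a , t) ∷ r) = Step s a t × Valid t r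

  -- finite path s₀ t₁ s₁ … tₗ sₗ : start state and list of (label, target) steps
  record FinPath : Set where
    constructor finPath
    field
      start : Fin n
      steps : List (Fin k × Fin n)
      valid : Valid start steps

  record InfPath : Set where
    constructor infPath
    field
      st    : ℕ → Fin n
      ac    : ℕ → Fin k
      valid : ∀ i → Step (st i) (ac i) (st (suc i))

  Path : Set
  Path = FinPath ⊎ InfPath

  IsFinite : Path → Set
  IsFinite (inj₁ _) = ⊤
  IsFinite (inj₂ _) = ⊥

  lastState : Fin n → List (Fin k × Fin n) → Fin n
  lastState s [] = s
  lastState s ((a , t) ∷ r) = lastState t r

  final : FinPath → Fin n
  final π = lastState (FinPath.start π) (FinPath.steps π)

  Enabled : Fin k → Fin n → Set
  Enabled a s = ∃ λ t → Step s a t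

  Locked : Subset k → Fin n → Set
  Locked B s = ∀ a → Enabled a s → a ∈ B

  Progressing : Subset k → Path → Set
  Progressing B (inj₁ π) = Locked B (final π)
  Progressing B (inj₂ _) = ⊤

  InfOften : Fin k → Path → Set
  InfOften a (inj₁ _) = ⊥
  InfOften a (inj₂ ρ) = ∀ i → ∃ λ j → i ≤ j × InfPath.ac ρ j ≡ a

  SuffixAllFin : (Fin n → Set) → Fin n → List (Fin k × Fin n) → Set
  SuffixAllFin Q s [] = Q s
  SuffixAllFin Q s ((a , t) ∷ r) =
    (Q s × All (λ p → Q (proj₂ p)) ((a , t) ∷ r)) ⊎ SuffixAllFin Q t r

  SuffixAll : (Fin n → Set) → Path → Set
  SuffixAll Q (inj₁ π) = SuffixAllFin Q (FinPath.start π) (FinPath.steps π)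
  SuffixAll Q (inj₂ ρ) = ∃ λ i → ∀ j → i ≤ j → Q (InfPath.st ρ j)

  PS : (B : Subset k) → ((a : Fin k) → a ∉ B → Form k 0) → Path → Set
  PS B φoff p = ∀ a (a∉B : a ∉ B) →
    InfOften a p ⊎ SuffixAll (λ s → s ⊨ φoff a a∉B) p

  PrefixInf : Fin n → List (Fin k × Fin n) → InfPath → ℕ → Set
  PrefixInf s [] ρ i = InfPath.st ρ i ≡ s
  PrefixInf s ((a , t) ∷ r) ρ i =
    InfPath.st ρ i ≡ s × InfPath.ac ρ i ≡ a × PrefixInf t r ρ (suc i)

  Prefix : FinPath → Path → Set
  Prefix π (inj₁ π′) = FinPath.start π ≡ FinPath.start π′ ×
    ∃ λ more → FinPath.steps π′ ≡ FinPath.steps π ++ more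
  Prefix π (inj₂ ρ) = PrefixInf (FinPath.start π) (FinPath.steps π) ρ 0

Feasible : {k : ℕ} → (B : Subset k) → ((a : Fin k) → a ∉ B → Form k 0) → Set
Feasible {k} B φoff = ∀ (M′ : LTS k) (π : FinPath M′) →
  ∃ λ (p : Path M′) → Prefix M′ π p × PS M′ B φoff p

{-# OPTIONS --safe #-}
module Submission where

open import Defs
open import Data.Nat using (ℕ)
open import Data.Fin using (Fin)
open import Data.Fin.Subset using (Subset; _∉_)
open import Function.Bundles using (_⇔_; Equivalence)
open import Data.List using (List; []; _∷_)
open import Data.Product using (_×_; _,_)
open import Data.Sum using (inj₁; inj₂)

module _ {k : ℕ} (M : LTS k) where
  open LTS M using (n)

  suffixAllFin-lastState : ∀ (Q : Fin n → Set) s (r : List (Fin k × Fin n)) →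
    Q (lastState M s r) → SuffixAllFin M Q s r
  suffixAllFin-lastState Q s []            q = q
  suffixAllFin-lastState Q s ((a , t) ∷ r) q = inj₂ (suffixAllFin-lastState Q t r q)

  suffixAll-final : ∀ (Q : Fin n → Set) (π : FinPath M) →
    Q (final M π) → SuffixAll M Q (inj₁ π)
  suffixAll-final Q (finPath s r _) = suffixAllFin-lastState Q s r

proposition58 : (k : ℕ) (M : LTS k) (B : Subset k)
    (φoff : (a : Fin k) → a ∉ B → Form k 0) →
    Feasible B φoff →
    (∀ (s : Fin (LTS.n M)) →
      Locked M B s ⇔ (∀ (a : Fin k) (a∉B : a ∉ B) → _⊨_ M s (φoff a a∉B))) →
    (p : Path M) → Progressing M B p → IsFinite M p → PS M B φoff p
proposition58 k M B φoff _ locked⇔off (inj₁ π) finalLocked _ a a∉B =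
  inj₂ (suffixAll-final M _ π (Equivalence.to (locked⇔off (final M π)) finalLocked a a∉B))
proposition58 _ _ _ _ _ _ (inj₂ _) _ ()
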